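{- Let $\mathbf{A}$ be a tense DRL-algebra and let $D$ be a tense filter of $\mathbf{A}$. Then $S_D=D\cap C(A)$ is a tense filter of $C(\mathbf{A})$.
   Context: A DRL-algebra is a structure $\langle A,\vee,\wedge,\ast,\sim,c,0,1\rangle$ such that, with $x\Rightarrow y:=\sim(x\ast(\sim y))$, $\langle A,\vee,\wedge,\ast,\Rightarrow,0,1\rangle$ is an integral commutative residuated lattice, $\sim$ is an involutive dual lattice automorphism, $\sim c=c$, and $(x\ast y)\wedge c=((x\wedge c)\ast y)\vee(x\ast(y\wedge c))$. A tense DRL-algebra is a DRL-algebra with unary $G,H$ such that, with $F(x):=\sim G(\sim x)$, $P(x):=\sim H(\sim x)$: (t0) $G(1)=H(1)=1$; (t1) $G(c)=H(c)=c$; (t2) $G,H$ preserve $\wedge$; (t3) $x\le GP(x)$, $x\le HF(x)$; (t4) $G(x\vee y)\le G(x)\vee F(y)$, $H(x\vee y)\le H(x)\vee P(y)$; (t5) $G(x\Rightarrow y)\le G(x)\Rightarrow G(y)$, $H(x\Rightarrow y)\le H(x)\Rightarrow H(y)$. A tense filter of $\mathbf{A}$ is a nonempty up-set closed under $\ast$, $G$ and $H$. $C(\mathbf{A})$ is the tense ICRDL-algebra on $C(A)=\{x\in A:x\ge c\}$ with $\vee,\wedge$ of $A$, product $x\cdot y=(x\ast y)\vee c$, $x\to y=\sim(x\ast(\sim y))$, bottom $c$, top $1$, and $G,H,F,P$ restricted from $A$; a tense filter of $C(\mathbf{A})$ is a nonempty up-set of $C(A)$ closed under $\cdot$, $G$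 and $H$. -}

module Defs where

open import Level using (Level; suc; _⊔_)
open import Data.Product using (_×_; Σ; ∃; _,_)
open import Relation.Binary.PropositionalEquality using (_≡_)
open import Algebra.Structures using (IsCommutativeMonoid)
open import Algebra.Lattice.Structures using (IsLattice)

record DRLAlgebra (a : Level) : Set (suc a) where
  infixr 6 _∨_
  infixr 7 _∧_
  infixl 8 _∗_
  infix 4 _≤_
  field
    Carrier : Set a
    _∨_ _∧_ _∗_ : Carrier → Carrier → Carrier
    ∼ : Carrier → Carrier
    c 𝟎 𝟏 : Carrier

  _≤_ : Carrier → Carrier → Set a
  x ≤ y = x ∧ y ≡ x

  _⇒_ : Carrier → Carrier → Carrier
  x ⇒ y = ∼ (x ∗ ∼ y)

  field
    -- ⟨A,∨,∧,∗,⇒,0,1⟩ is an integral commutative residuated lattice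
    isLattice : IsLattice _≡_ _∨_ _∧_
    ∗-isCommutativeMonoid : IsCommutativeMonoid _≡_ _∗_ 𝟏
    residuation₁ : ∀ x y z → x ∗ y ≤ z → x ≤ y ⇒ z
    residuation₂ : ∀ x y z → x ≤ y ⇒ z → x ∗ y ≤ z
    𝟏-top : ∀ x → x ≤ 𝟏
    𝟎-bottom : ∀ x → 𝟎 ≤ x
    ∼-involutive : ∀ x → ∼ (∼ x) ≡ x
    ∼-∨ : ∀ x y → ∼ (x ∨ y) ≡ ∼ x ∧ ∼ y
    ∼-∧ : ∀ x y → ∼ (x ∧ y) ≡ ∼ x ∨ ∼ y
    ∼c : ∼ c ≡ c
    c-law : ∀ x y → (x ∗ y) ∧ c ≡ ((x ∧ c) ∗ y) ∨ (x ∗ (y ∧ c))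

record TenseDRLAlgebra (a : Level) : Set (suc a) where
  field
    drl : DRLAlgebra a
  open DRLAlgebra drl public
  field
    G H : Carrier → Carrier

  F : Carrier → Carrier
  F x = ∼ (G (∼ x))

  P : Carrier → Carrier
  P x = ∼ (H (∼ x))

  field
    t0-G : G 𝟏 ≡ 𝟏
    t0-H : H 𝟏 ≡ 𝟏
    t1-G : G c ≡ c
    t1-H : H c ≡ c
    t2-G : ∀ x y → G (x ∧ y) ≡ G x ∧ G y
    t2-H : ∀ x y → H (x ∧ y) ≡ H x ∧ H y
    t3-GP : ∀ x → x ≤ G (P x)
    t3-HF : ∀ x → x ≤ H (F x)
    t4-G : ∀ x y → G (x ∨ y) ≤ G x ∨ F y
    t4-H : ∀ x y → H (x ∨ y) ≤ H x ∨ P y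
    t5-G : ∀ x y → G (x ⇒ y) ≤ G x ⇒ G y
    t5-H : ∀ x y → H (x ⇒ y) ≤ H x ⇒ H y

module _ {a : Level} (A : TenseDRLAlgebra a) where
  open TenseDRLAlgebra A

  record IsTenseFilter {ℓ : Level} (D : Carrier → Set ℓ) : Set (a ⊔ ℓ) where
    field
      nonempty : ∃ λ x → D x
      upset    : ∀ {x y} → D x → x ≤ y → D y
      ∗-closed : ∀ {x y} → D x → D y → D (x ∗ y)
      G-closed : ∀ {x} → D x → D (G x)
      H-closed : ∀ {x} → D x → D (H x)

  C : Carrier → Set a
  C x = c ≤ x

  _·_ : Carrier → Carrier → Carrier
  x · y = (x ∗ y) ∨ c

  -- tense filter of C(A), given as a predicate S on A with S ⊆ C(A):
  -- nonempty up-set of C(A) closed under ·, G and H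
  record IsTenseFilterC {ℓ : Level} (S : Carrier → Set ℓ) : Set (a ⊔ ℓ) where
    field
      ⊆C       : ∀ {x} → S x → C x
      nonempty : ∃ λ x → S x
      upset    : ∀ {x y} → S x → C y → x ≤ y → S y
      ·-closed : ∀ {x y} → S x → S y → S (x · y)
      G-closed : ∀ {x} → S x → S (G x)
      H-closed : ∀ {x} → S x → S (H x)

  S_ : ∀ {ℓ} → (Carrier → Set ℓ) → Carrier → Set (a ⊔ ℓ)
  S_ D x = D x × C x

{-# OPTIONS --safe #-}
module Submission where

open import Defs
open import Level using (Level)
open import Data.Product using (_,_; proj₂)
open import Relation.Binary.PropositionalEquality
open import Algebra.Lattice.Structures using (IsLattice)

∧-hom-monotone : ∀ {a} {A : Set a} {_∧_ : A → A → A} (K : A → A) →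
                 (∀ x y → K (x ∧ y) ≡ K x ∧ K y) →
                 ∀ {x y} → x ∧ y ≡ x → K x ∧ K y ≡ K x
∧-hom-monotone {_∧_ = _∧_} K K-∧ {x} {y} x≤y = begin
  K x ∧ K y ≡⟨ sym (K-∧ x y) ⟩
  K (x ∧ y) ≡⟨ cong K x≤y ⟩
  K x       ∎
  where open ≡-Reasoning

module _ {a : Level} {A : Set a} {_∨_ _∧_ : A → A → A}
         (isLattice : IsLattice _≡_ _∨_ _∧_) where
  open IsLattice isLattice using (∨-comm; absorptive)

  y≤x∨y : ∀ x y → y ∧ (x ∨ y) ≡ y
  y≤x∨y x y = trans (cong (y ∧_) (∨-comm x y)) (proj₂ absorptive y x)

  x≤x∨y : ∀ x y → x ∧ (x ∨ y) ≡ x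
  x≤x∨y = proj₂ absorptive

module _ {a : Level} (A : TenseDRLAlgebra a) where
  open TenseDRLAlgebra A

  ∧-hom-fixing-c-preserves-C : (K : Carrier → Carrier) → K c ≡ c →
                               (∀ x y → K (x ∧ y) ≡ K x ∧ K y) →
                               ∀ {x} → C A x → C A (K x)
  ∧-hom-fixing-c-preserves-C K Kc≡c K-∧ {x} c≤x =
    subst (λ k → k ∧ K x ≡ k) Kc≡c (∧-hom-monotone K K-∧ c≤x)

  ·-in-C : ∀ x y → C A (_·_ A x y)
  ·-in-C x y = y≤x∨y isLattice (x ∗ y) c

  ∗≤· : ∀ x y → x ∗ y ≤ _·_ A x y
  ∗≤· x y = x≤x∨y isLattice (x ∗ y) c

  module _ {ℓ : Level} {D : Carrier → Set ℓ} (D-filter : IsTenseFilter A D) where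
    open IsTenseFilter D-filter

    𝟏∈D : D 𝟏
    𝟏∈D = upset (proj₂ nonempty) (𝟏-top _)

    ·-closed-D : ∀ {x y} → D x → D y → D (_·_ A x y)
    ·-closed-D Dx Dy = upset (∗-closed Dx Dy) (∗≤· _ _)

mainTheorem16 : ∀ {a ℓ : Level} (A : TenseDRLAlgebra a) (D : TenseDRLAlgebra.Carrier A → Set ℓ)
    → IsTenseFilter A D → IsTenseFilterC A (S_ A D)
mainTheorem16 A D D-filter = record
  { ⊆C       = proj₂
  ; nonempty = 𝟏 , 𝟏∈D A D-filter , 𝟏-top c
  ; upset    = λ (Dx , _) Cy x≤y → upset Dx x≤y , Cy
  ; ·-closed = λ {x} {y} (Dx , _) (Dy , _) → ·-closed-D A D-filter Dx Dy , ·-in-C A x y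
  ; G-closed = λ (Dx , Cx) → G-closed Dx , ∧-hom-fixing-c-preserves-C A G t1-G t2-G Cx
  ; H-closed = λ (Dx , Cx) → H-closed Dx , ∧-hom-fixing-c-preserves-C A H t1-H t2-H Cx
  }
  where
  open TenseDRLAlgebra A
  open IsTenseFilter D-filter
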